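{- Let a connected regular graph $G$ be factored into graphs $H$ and $K$. Then both $H$ and $K$ are regular.
   Context: All graphs are finite and simple. A graph $G$ is factored into graphs $H$ and $K$ (all on $n$ vertices) if there exist adjacency matrices $A,B,C$ of $G,H,K$ respectively (symmetric $n\times n$ $(0,1)$-matrices with zero diagonal, for some vertex orderings) with $A=BC$; the three graphs are then regarded as having the common vertex set $\{1,\dots,n\}$. -}

module Defs where

open import Data.Nat using (ℕ; zero; suc; _+_; _*_)
open import Data.Fin using (Fin)
open import Data.List using (List; []; _∷_)
open import Data.Product using (Σ; ∃; _×_; _,_)
open import Data.Sum using (_⊎_)
open import Relation.Binary.PropositionalEquality using (_≡_)

Σᶠ : ∀ {n} → (Fin n → ℕ) → ℕ
Σᶠ {zero}  f = 0
Σᶠ {suc n} f = f Fin.zero + Σᶠ (λ i → f (Fin.suc i))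

Mat : ℕ → Set
Mat n = Fin n → Fin n → ℕ

-- matrix product (over ℕ, which agrees with ordinary integer product
-- for (0,1)-matrices)
_⊗_ : ∀ {n} → Mat n → Mat n → Mat n
(B ⊗ C) i j = Σᶠ (λ k → B i k * C k j)

IsAdjacency : ∀ {n} → Mat n → Set
IsAdjacency {n} A =
  (∀ i j → A i j ≡ 0 ⊎ A i j ≡ 1) ×
  (∀ i j → A i j ≡ A j i) ×
  (∀ i → A i i ≡ 0)

degree : ∀ {n} → Mat n → Fin n → ℕ
degree A i = Σᶠ (λ j → A i j)

IsRegular : ∀ {n} → Mat n → Set
IsRegular {n} A = Σ ℕ (λ k → ∀ (i : Fin n) → degree A i ≡ k)

data Walk {n} (A : Mat n) : Fin n → Fin n → Set where
  here : ∀ {u} → Walk A u u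
  step : ∀ {u w v} → A u w ≡ 1 → Walk A w v → Walk A u v

IsConnected : ∀ {n} → Mat n → Set
IsConnected {n} A = ∀ (u v : Fin n) → Walk A u v

{-# OPTIONS --safe #-}
-- Since A, B and C are symmetric, A = BC = CB. So the degree vector d = B𝟙 of B
-- satisfies Ad = BCB𝟙 = BA𝟙 = rd, where r is the degree of G: d is harmonic for G.
-- At a vertex u where d is maximal, r·d(u) = Σ_w A_uw d(w) forces d(w) = d(u) at every
-- neighbour w, and since G is connected the maximum spreads to every vertex. The same
-- argument with B and C exchanged shows that C is regular.
module Submission where

open import Defs
open import Data.Nat using (ℕ; zero; suc; _+_; _*_; _≤_; _<_; z≤n)
open import Data.Nat.Properties
open import Algebra.Properties.Semiring.Sum +-*-semiring
  using (sum; sum-cong-≗; ∑-comm; *-distribˡ-sum; *-distribʳ-sum)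
open import Data.Fin using (Fin)
open import Data.List using (allFin)
open import Data.List.Extrema ≤-totalOrder using (argmax; f[xs]≤f[argmax])
open import Data.List.Membership.Propositional.Properties using (∈-allFin)
import Data.List.Relation.Unary.All as All
open import Data.Product using (Σ; ∃; _×_; _,_; proj₁; proj₂)
open import Function using (const)
open import Relation.Binary.PropositionalEquality
open import Relation.Nullary using (¬_)

private
  variable
    m n : ℕ

Σᶠ≡sum : (f : Fin n → ℕ) → Σᶠ f ≡ sum f
Σᶠ≡sum {zero}  f = refl
Σᶠ≡sum {suc n} f = cong (f Fin.zero +_) (Σᶠ≡sum (λ i → f (Fin.suc i)))

Σᶠ-cong : {f g : Fin n → ℕ} → f ≗ g → Σᶠ f ≡ Σᶠ g
Σᶠ-cong {f = f} {g} f≗g = begin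
  Σᶠ f   ≡⟨ Σᶠ≡sum f ⟩
  sum f  ≡⟨ sum-cong-≗ f≗g ⟩
  sum g  ≡⟨ Σᶠ≡sum g ⟨
  Σᶠ g   ∎
  where open ≡-Reasoning

Σᶠ²≡sum² : (f : Fin m → Fin n → ℕ) → Σᶠ (λ i → Σᶠ (f i)) ≡ sum (λ i → sum (f i))
Σᶠ²≡sum² f = trans (Σᶠ≡sum (λ i → Σᶠ (f i))) (sum-cong-≗ (λ i → Σᶠ≡sum (f i)))

Σᶠ-comm : (f : Fin m → Fin n → ℕ) →
          Σᶠ (λ i → Σᶠ (f i)) ≡ Σᶠ (λ j → Σᶠ (λ i → f i j))
Σᶠ-comm f = begin
  Σᶠ (λ i → Σᶠ (f i))             ≡⟨ Σᶠ²≡sum² f ⟩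
  sum (λ i → sum (f i))           ≡⟨ ∑-comm f ⟩
  sum (λ j → sum (λ i → f i j))   ≡⟨ Σᶠ²≡sum² (λ j i → f i j) ⟨
  Σᶠ (λ j → Σᶠ (λ i → f i j))     ∎
  where open ≡-Reasoning

*-distribˡ-Σᶠ : ∀ c (f : Fin n → ℕ) → c * Σᶠ f ≡ Σᶠ (λ i → c * f i)
*-distribˡ-Σᶠ c f = begin
  c * Σᶠ f                 ≡⟨ cong (c *_) (Σᶠ≡sum f) ⟩
  c * sum f                ≡⟨ *-distribˡ-sum c f ⟩
  sum (λ i → c * f i)      ≡⟨ Σᶠ≡sum (λ i → c * f i) ⟨
  Σᶠ (λ i → c * f i)       ∎
  where open ≡-Reasoning

*-distribʳ-Σᶠ : ∀ c (f : Fin n → ℕ) → Σᶠ f * c ≡ Σᶠ (λ i → f i * c)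
*-distribʳ-Σᶠ c f = begin
  Σᶠ f * c                 ≡⟨ cong (_* c) (Σᶠ≡sum f) ⟩
  sum f * c                ≡⟨ *-distribʳ-sum c f ⟩
  sum (λ i → f i * c)      ≡⟨ Σᶠ≡sum (λ i → f i * c) ⟨
  Σᶠ (λ i → f i * c)       ∎
  where open ≡-Reasoning

Σᶠ-mono-≤ : {f g : Fin n → ℕ} → (∀ i → f i ≤ g i) → Σᶠ f ≤ Σᶠ g
Σᶠ-mono-≤ {zero}  f≤g = z≤n
Σᶠ-mono-≤ {suc n} f≤g = +-mono-≤ (f≤g Fin.zero) (Σᶠ-mono-≤ (λ i → f≤g (Fin.suc i)))

Σᶠ-mono-< : {f g : Fin n → ℕ} → (∀ i → f i ≤ g i) → ∀ k → f k < g k → Σᶠ f < Σᶠ g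
Σᶠ-mono-< f≤g Fin.zero    fk<gk = +-mono-<-≤ fk<gk (Σᶠ-mono-≤ (λ i → f≤g (Fin.suc i)))
Σᶠ-mono-< f≤g (Fin.suc k) fk<gk = +-mono-≤-< (f≤g Fin.zero) (Σᶠ-mono-< (λ i → f≤g (Fin.suc i)) k fk<gk)

argmaxᶠ : (f : Fin (suc n) → ℕ) → ∃ λ u → ∀ v → f v ≤ f u
argmaxᶠ {n} f = argmax f Fin.zero (allFin (suc n))
              , λ v → All.lookup (f[xs]≤f[argmax] {f = f} Fin.zero (allFin (suc n))) (∈-allFin v)

Constant : (Fin n → ℕ) → Set
Constant d = Σ ℕ λ k → ∀ i → d i ≡ k

Symmetric : Mat n → Set
Symmetric M = ∀ i j → M i j ≡ M j i

infix 4 _≐_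
_≐_ : Mat n → Mat n → Set
M ≐ N = ∀ i j → M i j ≡ N i j

infixr 7 _·_
_·_ : Mat n → (Fin n → ℕ) → Fin n → ℕ
(M · x) i = Σᶠ (λ j → M i j * x j)

·-congˡ : {M N : Mat n} → M ≐ N → ∀ x → M · x ≗ N · x
·-congˡ M≐N x i = Σᶠ-cong (λ j → cong (_* x j) (M≐N i j))

·-congʳ : (M : Mat n) {x y : Fin n → ℕ} → x ≗ y → M · x ≗ M · y
·-congʳ M x≗y i = Σᶠ-cong (λ j → cong (M i j *_) (x≗y j))

⊗-· : (M N : Mat n) (x : Fin n → ℕ) → (M ⊗ N) · x ≗ M · (N · x)
⊗-· M N x i = begin
  Σᶠ (λ j → Σᶠ (λ k → M i k * N k j) * x j)    ≡⟨ Σᶠ-cong (λ j → *-distribʳ-Σᶠ (x j) (λ k → M i k * N k j)) ⟩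
  Σᶠ (λ j → Σᶠ (λ k → M i k * N k j * x j))    ≡⟨ Σᶠ-comm (λ j k → M i k * N k j * x j) ⟩
  Σᶠ (λ k → Σᶠ (λ j → M i k * N k j * x j))    ≡⟨ Σᶠ-cong (λ k → Σᶠ-cong (λ j → *-assoc (M i k) (N k j) (x j))) ⟩
  Σᶠ (λ k → Σᶠ (λ j → M i k * (N k j * x j)))  ≡⟨ Σᶠ-cong (λ k → *-distribˡ-Σᶠ (M i k) (λ j → N k j * x j)) ⟨
  Σᶠ (λ k → M i k * Σᶠ (λ j → N k j * x j))    ∎
  where open ≡-Reasoning

·-const : (M : Mat n) (c : ℕ) → M · const c ≗ λ i → degree M i * c
·-const M c i = sym (*-distribʳ-Σᶠ c (M i))

degree≗·𝟙 : (M : Mat n) → degree M ≗ M · const 1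
degree≗·𝟙 M i = trans (sym (*-identityʳ (degree M i))) (sym (·-const M 1 i))

⊗-transpose : {M N : Mat n} → Symmetric M → Symmetric N → ∀ i j → (M ⊗ N) i j ≡ (N ⊗ M) j i
⊗-transpose {M = M} {N} symM symN i j =
  Σᶠ-cong (λ k → trans (cong₂ _*_ (symM i k) (symN k j)) (*-comm (M k i) (N j k)))

degree-harmonic : {A X Y : Mat n} {r : ℕ} → A ≐ X ⊗ Y → A ≐ Y ⊗ X → (∀ i → degree A i ≡ r) →
                  A · degree X ≗ λ i → r * degree X i
degree-harmonic {A = A} {X} {Y} {r} A≐XY A≐YX regA i = begin
  (A · degree X) i          ≡⟨ ·-congˡ A≐XY (degree X) i ⟩
  ((X ⊗ Y) · degree X) i    ≡⟨ ⊗-· X Y (degree X) i ⟩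
  (X · Y · degree X) i      ≡⟨ ·-congʳ X Y·degreeX≗r i ⟩
  (X · const r) i           ≡⟨ ·-const X r i ⟩
  degree X i * r            ≡⟨ *-comm (degree X i) r ⟩
  r * degree X i            ∎
  where
  open ≡-Reasoning
  Y·degreeX≗r : Y · degree X ≗ const r
  Y·degreeX≗r j = begin
    (Y · degree X) j         ≡⟨ ·-congʳ Y (degree≗·𝟙 X) j ⟩
    (Y · X · const 1) j      ≡⟨ ⊗-· Y X (const 1) j ⟨
    ((Y ⊗ X) · const 1) j    ≡⟨ ·-congˡ A≐YX (const 1) j ⟨
    (A · const 1) j          ≡⟨ degree≗·𝟙 A j ⟨
    degree A j               ≡⟨ regA j ⟩
    r                        ∎

maximum-spreads : {A : Mat n} {r : ℕ} {d : Fin n → ℕ} {u w : Fin n} →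
                  degree A u ≡ r → (A · d) u ≡ r * d u → (∀ v → d v ≤ d u) →
                  A u w ≡ 1 → d w ≡ d u
maximum-spreads {A = A} {r} {d} {u} {w} degAu Ad≡rd d≤du uw = ≤-antisym (d≤du w) (≮⇒≥ dw≮du)
  where
  Ad≡A·du : (A · d) u ≡ (A · const (d u)) u
  Ad≡A·du = begin
    (A · d) u               ≡⟨ Ad≡rd ⟩
    r * d u                 ≡⟨ cong (_* d u) degAu ⟨
    degree A u * d u        ≡⟨ ·-const A (d u) u ⟨
    (A · const (d u)) u     ∎
    where open ≡-Reasoning
  dw≮du : ¬ d w < d u
  dw≮du dw<du = <-irrefl Ad≡A·du
    (Σᶠ-mono-< (λ v → *-monoʳ-≤ (A u v) (d≤du v)) w
               (subst (λ a → a * d w < a * d u) (sym uw) (*-monoʳ-< 1 dw<du)))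

Walk-preserves : {A : Mat n} (P : Fin n → Set) → (∀ {u w} → A u w ≡ 1 → P u → P w) →
                 ∀ {u v} → Walk A u v → P u → P v
Walk-preserves P step-P here          Pu = Pu
Walk-preserves P step-P (step uw wv) Pu = Walk-preserves P step-P wv (step-P uw Pu)

harmonic⇒constant : {A : Mat n} {r : ℕ} {d : Fin n → ℕ} → IsConnected A →
                    (∀ i → degree A i ≡ r) → (A · d ≗ λ i → r * d i) → Constant d
harmonic⇒constant {zero}              conn regA harmonic = 0 , λ ()
harmonic⇒constant {suc n} {A} {r} {d} conn regA harmonic =
  d u , λ v → Walk-preserves (λ x → d x ≡ d u) spread (conn u v) refl
  where
  u = proj₁ (argmaxᶠ d)
  d≤du : ∀ v → d v ≤ d u
  d≤du = proj₂ (argmaxᶠ d)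
  spread : ∀ {x w} → A x w ≡ 1 → d x ≡ d u → d w ≡ d u
  spread {x} xw dx≡du = trans
    (maximum-spreads {A = A} (regA x) (harmonic x) (λ v → subst (d v ≤_) (sym dx≡du) (d≤du v)) xw)
    dx≡du

theorem4p4 : ∀ (n : ℕ) (A B C : Mat n) →
    IsAdjacency A → IsAdjacency B → IsAdjacency C →
    (∀ i j → A i j ≡ (B ⊗ C) i j) →
    IsConnected A → IsRegular A →
    IsRegular B × IsRegular C
theorem4p4 n A B C (_ , symA , _) (_ , symB , _) (_ , symC , _) A≐BC conn (r , regA) =
  factor-regular A≐BC A≐CB , factor-regular A≐CB A≐BC
  where
  A≐CB : A ≐ C ⊗ B
  A≐CB i j = trans (symA i j) (trans (A≐BC j i) (⊗-transpose symB symC j i))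
  factor-regular : {X Y : Mat n} → A ≐ X ⊗ Y → A ≐ Y ⊗ X → IsRegular X
  factor-regular A≐XY A≐YX = harmonic⇒constant conn regA (degree-harmonic A≐XY A≐YX regA)
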